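{- Let $a$ be a positive integer. Write $n = \lfloor \sqrt{a} \rfloor$ and $b = a - n^2$ (so $0 \le b \le 2n$), and $m = n+1$ and $c = m^2 - a$ (so $1 \le c \le 2m-1$). Define $$\sigma_l(a) = \frac{n + \sqrt{a+1}}{b+1}, \qquad \sigma_r(a) = \frac{m + \sqrt{a}}{c},$$ and for a positive integer $k$ define $\sigma_k(a) = \lfloor \max\{k\,\sigma_l(a),\, k\,\sigma_r(a)\} \rfloor + 1$. Then: (1) For every positive integer $k$ and every positive integer $s$, if $s \le \max\{k\,\sigma_l(a),\, k\,\sigma_r(a)\}$ then $\tau_s(a) < k$. (2) For every positive integer $k$ and every positive integer $s$, if $\tau_s(a) \ge k$ then $s \ge \sigma_k(a)$. (3) $\sigma_1(a) \le \sigma(a) \le \lceil \sqrt{a+1} + \sqrt{a} \rceil$.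
   Context: For a positive integer $a$ and a positive integer $s$, let $T_s(a)$ be the set of all positive integers $t$ with $s^2 a < t^2 < s^2(a+1)$, and let $\tau_s(a) = |T_s(a)|$. Let $\sigma(a)$ be the least positive integer $s$ such that $T_s(a) \neq \varnothing$ (equivalently, the smallest denominator of a rational number in the open interval $(\sqrt{a}, \sqrt{a+1})$). -}

module Defs where

open import Data.Nat using (ℕ; zero; suc; _+_; _*_; _∸_; _^_; _≤_; _<_; _≤ᵇ_; _⊔_; _<?_; _/_)
open import Data.Bool using (if_then_else_)
open import Data.List using (List; filter; upTo; length)
open import Data.Product using (_×_; ∃)
open import Data.Sum using (_⊎_)
open import Relation.Nullary using (¬_)
open import Relation.Nullary.Decidable using (_×-dec_)

-- Integer square root:  isqrt x = ⌊ √x ⌋  (largest r with r² ≤ x).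
-- (⌊√(x+1)⌋ is either ⌊√x⌋ or ⌊√x⌋ + 1.)

isqrt : ℕ → ℕ
isqrt zero = zero
isqrt (suc x) =
  if suc (isqrt x) * suc (isqrt x) ≤ᵇ suc x then suc (isqrt x) else isqrt x

InT : ℕ → ℕ → ℕ → Set
InT a s t = (s ^ 2 * a < t ^ 2) × (t ^ 2 < s ^ 2 * (a + 1))

-- τ_s(a) = |T_s(a)|.  Every t ∈ T_s(a) satisfies t < s·(a+1)
-- (since t² < s²(a+1) ≤ (s(a+1))²), so we count over upTo (s * (a + 1)).
τ : ℕ → ℕ → ℕ
τ s a = length (filter (λ t → (s ^ 2 * a <? t ^ 2) ×-dec (t ^ 2 <? s ^ 2 * (a + 1)))
                       (upTo (s * (a + 1))))

IsSigma : ℕ → ℕ → Set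
IsSigma a s =
  (1 ≤ s) × (∃ λ t → InT a s t) ×
  (∀ s′ → 1 ≤ s′ → s′ < s → ∀ t → ¬ InT a s′ t)

-- Real numbers of the form (p + √q) / d  (p q d : ℕ, d ≥ 1),
-- represented by the triple (p, q, d).

record Surd : Set where
  constructor surd
  field
    num : ℕ
    rad : ℕ
    den : ℕ

-- s ≤ (p + √q)/d   ⇔   s·d − p ≤ √q   ⇔   (s·d ∸ p)² ≤ q
-- (if s·d ≤ p both sides hold trivially; truncated subtraction gives 0).
_≤ˢ_ : ℕ → Surd → Set
s ≤ˢ surd p q d = (s * d ∸ p) ^ 2 ≤ q

-- ⌊ (p + √q)/d ⌋ = ⌊ (p + ⌊√q⌋)/d ⌋   (d ≥ 1; value 0 for the unused d = 0)
⌊_⌋ˢ : Surd → ℕ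
⌊ surd p q zero ⌋ˢ = zero
⌊ surd p q (suc e) ⌋ˢ = (p + isqrt q) / suc e

nA : ℕ → ℕ
nA a = isqrt a

bA : ℕ → ℕ
bA a = a ∸ nA a ^ 2

mA : ℕ → ℕ
mA a = nA a + 1

cA : ℕ → ℕ
cA a = mA a ^ 2 ∸ a

-- k·σ_l(a) = k (n + √(a+1)) / (b+1) = (k n + √(k² (a+1))) / (b+1)
kσl : ℕ → ℕ → Surd
kσl k a = surd (k * nA a) (k ^ 2 * (a + 1)) (bA a + 1)

-- k·σ_r(a) = k (m + √a) / c = (k m + √(k² a)) / c
kσr : ℕ → ℕ → Surd
kσr k a = surd (k * mA a) (k ^ 2 * a) (cA a)

_≤max[_,_] : ℕ → ℕ → ℕ → Set
s ≤max[ k , a ] = (s ≤ˢ kσl k a) ⊎ (s ≤ˢ kσr k a)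

-- σ_k(a) = ⌊ max { k σ_l(a), k σ_r(a) } ⌋ + 1
--        = max { ⌊k σ_l(a)⌋, ⌊k σ_r(a)⌋ } + 1
σ_ : ℕ → ℕ → ℕ
σ_ k a = (⌊ kσl k a ⌋ˢ ⊔ ⌊ kσr k a ⌋ˢ) + 1

-- √(a+1) + √a ≤ u  for a natural number u.  With r = a, q = a+1:
-- √q + √r ≤ u ⇔ √r ≤ u ∧ q ≤ (u − √r)² ⇔ r ≤ u² ∧ 2u√r ≤ u² + r − q
--            ⇔ r ≤ u² ∧ q ≤ u² + r ∧ 4u²r ≤ (u² + r − q)².
SqrtSum≤ : ℕ → ℕ → Set
SqrtSum≤ a u =
  (a ≤ u ^ 2) × (a + 1 ≤ u ^ 2 + a) × (4 * u ^ 2 * a ≤ (u ^ 2 + a ∸ (a + 1)) ^ 2)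

IsCeilSqrtSum : ℕ → ℕ → Set
IsCeilSqrtSum a u = SqrtSum≤ a u × (∀ v → SqrtSum≤ a v → u ≤ v)

module Submission where

-- Write N = ⌊√a⌋, M = N + 1, B = b + 1 = a + 1 − N² and c = M² − a.
-- (1) Every t ∈ T_s(a) satisfies sN < t < sM.  If s ≤ kσ_l(a), the
--     identity (sB − kN)² + B(sN + k)² = (k² + Bs²)(a + 1) shows
--     s√(a+1) ≤ sN + k, so T_s(a) lies in the window (sN, sN + k); if
--     s ≤ kσ_r(a), the identity (sc − kM)² + c·s²a = k²a + c(sM − k)²
--     shows sM − k ≤ s√a, so T_s(a) lies in the window (sM − k, sM).
--     A window of width k contains fewer than k integers, so τ_s(a) < k.
-- (2) If τ_s(a) ≥ k then s exceeds both kσ_l(a) and kσ_r(a) by (1), hence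
--     s > ⌊max{kσ_l(a), kσ_r(a)}⌋, i.e. s ≥ σ_k(a).
-- (3) Every element of T_s(a) is at least ⌊s√a⌋ + 1, so T_s(a) ≠ ∅ iff
--     this candidate lies in T_s(a), which is decidable; it does for s = 2M, so the least-number principle gives
--     σ(a).  Since T_σ(a)(a) is nonempty it fits in no window of width 1,
--     whence σ_1(a) ≤ σ(a) as in (2).  Finally, if √(a+1) + √a ≤ u then
--     the candidate ⌊u√a⌋ + 1 lies in T_u(a), so σ(a) ≤ u.

open import Defs
open import Data.Nat using (ℕ; _≤_; _<_; _≥_)
open import Data.Product using (_×_; ∃)
open import Data.Nat
open import Data.Nat.Properties
open import Data.Nat.DivMod using (m<n*o⇒m/o<n)
open import Data.Nat.Divisibility using (_∣_; divides; ∣m+n∣m⇒∣n; m∣m*n; ∣1⇒≡1)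
open import Data.Nat.Solver using (module +-*-Solver)
open import Data.Bool using (true; false; T)
open import Data.Unit using (tt)
open import Data.Product using (_,_; proj₁; proj₂)
open import Data.Sum using (_⊎_; inj₁; inj₂)
open import Data.List using (List; []; _∷_; length; upTo)
open import Data.List.Relation.Unary.All using (All; []; _∷_)
import Data.List.Relation.Unary.All as All
import Data.List.Relation.Unary.All.Properties as AllP
open import Data.List.Relation.Unary.AllPairs using (AllPairs; []; _∷_)
import Data.List.Relation.Unary.AllPairs.Properties as AllPairsP
open import Function using (id)
open import Relation.Nullary using (¬_; Dec; yes; no; contradiction)
open import Relation.Nullary.Decidable using (_×-dec_; map′)
open import Relation.Unary using (Decidable)
open import Relation.Binary.PropositionalEquality
open +-*-Solver using (solve; _:=_; _:+_; _:*_; _:^_; con)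


square-reflects-< : ∀ {m n} → m ^ 2 < n ^ 2 → m < n
square-reflects-< lt = ≰⇒> (λ n≤m → <⇒≱ lt (^-monoˡ-≤ 2 n≤m))

square-reflects-≤ : ∀ {m n} → m ^ 2 ≤ n ^ 2 → m ≤ n
square-reflects-≤ le = ≮⇒≥ (λ n<m → <⇒≱ (^-monoˡ-< 2 n<m) le)

product-square : ∀ m n → (m * n) ^ 2 ≡ m ^ 2 * n ^ 2
product-square = solve 2 (λ m n → (m :* n) :^ 2 := m :^ 2 :* n :^ 2) refl

monus-square : ∀ {m n} → n ≤ m → (m ∸ n) ^ 2 + 2 * m * n ≡ m ^ 2 + n ^ 2
monus-square {m} {n} n≤m = begin
  (m ∸ n) ^ 2 + 2 * m * n         ≡⟨ cong (λ x → (m ∸ n) ^ 2 + 2 * x * n) (sym (m∸n+n≡m n≤m)) ⟩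
  (m ∸ n) ^ 2 + 2 * (m ∸ n + n) * n ≡⟨ expand (m ∸ n) n ⟩
  (m ∸ n + n) ^ 2 + n ^ 2         ≡⟨ cong (λ x → x ^ 2 + n ^ 2) (m∸n+n≡m n≤m) ⟩
  m ^ 2 + n ^ 2                   ∎
  where
  open ≡-Reasoning
  expand : ∀ d n → d ^ 2 + 2 * (d + n) * n ≡ (d + n) ^ 2 + n ^ 2
  expand = solve 2 (λ d n → d :^ 2 :+ con 2 :* (d :+ n) :* n := (d :+ n) :^ 2 :+ n :^ 2) refl

square : ∀ n → n ^ 2 ≡ n * n
square n = cong (n *_) (*-identityʳ n)

isqrt-spec : ∀ x → isqrt x ^ 2 ≤ x × x < suc (isqrt x) ^ 2
isqrt-spec zero = z≤n , s≤s z≤n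
isqrt-spec (suc x) with isqrt x | isqrt-spec x
... | r | r²≤x , x<[r+1]² with suc r * suc r ≤ᵇ suc x in test
... | true  = subst (_≤ suc x) (sym (square (suc r))) (≤ᵇ⇒≤ _ _ (subst T (sym test) tt))
            , ≤-<-trans x<[r+1]² (^-monoˡ-< 2 (n<1+n (suc r)))
... | false = ≤-trans r²≤x (n≤1+n x)
            , ≰⇒> (λ le → subst T test (≤⇒≤ᵇ (subst (_≤ suc x) (square (suc r)) le)))

module Parameters (a : ℕ) where
  N M B c : ℕ
  N = nA a
  M = mA a
  B = bA a + 1
  c = cA a

  N²≤a : N ^ 2 ≤ a
  N²≤a = proj₁ (isqrt-spec a)

  a<M² : a < M ^ 2
  a<M² = subst (λ m → a < m ^ 2) (+-comm 1 N) (proj₂ (isqrt-spec a))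

  N²+B≡a+1 : N ^ 2 + B ≡ a + 1
  N²+B≡a+1 = trans (sym (+-assoc (N ^ 2) (bA a) 1)) (cong (_+ 1) (m+[n∸m]≡n N²≤a))

  a+c≡M² : a + c ≡ M ^ 2
  a+c≡M² = m+[n∸m]≡n (<⇒≤ a<M²)

  B>0 : 0 < B
  B>0 = m≤n+m 1 (bA a)

  c>0 : 0 < c
  c>0 = m<n⇒0<n∸m a<M²

Window : ℕ → ℕ → ℕ → ℕ → Set
Window a s L k = ∀ t → InT a s t → L < t × t < L + k

InT-between : ∀ {a s t L H} → L ^ 2 ≤ s ^ 2 * a → s ^ 2 * (a + 1) ≤ H ^ 2 →
              InT a s t → L < t × t < H
InT-between L²≤s²a s²[a+1]≤H² (s²a<t² , t²<s²[a+1]) =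
  square-reflects-< (≤-<-trans L²≤s²a s²a<t²) , square-reflects-< (<-≤-trans t²<s²[a+1] s²[a+1]≤H²)

increasing-length : ∀ {L H} (xs : List ℕ) → L < H → All (λ t → L < t × t < H) xs →
                    AllPairs _<_ xs → L + length xs < H
increasing-length {L} [] L<H [] [] = subst (_< _) (sym (+-identityʳ L)) L<H
increasing-length {L} {H} (x ∷ xs) L<H ((L<x , x<H) ∷ inside) (x<xs ∷ increasing) =
  subst (_< H) (sym (+-suc L (length xs)))
    (≤-<-trans (+-monoˡ-≤ (length xs) L<x)
      (increasing-length xs x<H (All.zipWith (λ (x<t , _ , t<H) → x<t , t<H) (x<xs , inside)) increasing))

-- τ_s(a) is the length of a strictly increasing list of elements of T_s(a),
-- so a window of width k ≥ 1 around T_s(a) forces τ_s(a) < k.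
τ<width : ∀ {a s L k} → 0 < k → Window a s L k → τ s a < k
τ<width {a} {s} {L} {k} k>0 window = +-cancelˡ-< L _ _
  (increasing-length _ (m<m+n L k>0)
    (All.map (λ {t} → window t) (AllP.all-filter InT? (upTo (s * (a + 1)))))
    (AllPairsP.filter⁺ InT? (AllPairsP.applyUpTo⁺₁ id (s * (a + 1)) (λ i<j _ → i<j))))
  where
  InT? : Decidable (InT a s)
  InT? t = (s ^ 2 * a <? t ^ 2) ×-dec (t ^ 2 <? s ^ 2 * (a + 1))

width-one-empty : ∀ {a s L} t → Window a s L 1 → ¬ InT a s t
width-one-empty {L = L} t window t∈T with window t t∈T
... | L<t , t<L+1 = <⇒≱ L<t (m<1+n⇒m≤n (subst (t <_) (+-comm L 1) t<L+1))

weighted-cancel : ∀ {D Y c P Q} → 0 < c → D ≤ Y → D + c * P ≡ Y + c * Q → Q ≤ P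
weighted-cancel {D} {Y} {c} {P} {Q} c>0 D≤Y eq =
  *-cancelˡ-≤ c {{>-nonZero c>0}} (+-cancelˡ-≤ Y _ _ (begin
    Y + c * Q ≡⟨ eq ⟨
    D + c * P ≤⟨ +-monoˡ-≤ (c * P) D≤Y ⟩
    Y + c * P ∎))
  where open ≤-Reasoning

swap-last : ∀ x y z → x + y + z ≡ x + z + y
swap-last = solve 3 (λ x y z → x :+ y :+ z := x :+ z :+ y) refl

-- Left estimate: if N² + B = q with B > 0 and sB − kN ≤ k√q, then s√q ≤ sN + k.
-- When kN ≤ sB this rests on the identity (sB − kN)² + B(sN + k)² = k²q + B·s²q.
left-bound : ∀ {q N B s k} → 0 < B → N ^ 2 + B ≡ q →
             (s * B ∸ k * N) ^ 2 ≤ k ^ 2 * q → s ^ 2 * q ≤ (s * N + k) ^ 2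
left-bound {q} {N} {B} {s} {k} B>0 N²+B≡q hyp with k * N ≤? s * B
... | yes kN≤sB = weighted-cancel B>0 hyp (+-cancelʳ-≡ (2 * (s * B) * (k * N)) _ _ (begin
    (s * B ∸ k * N) ^ 2 + B * (s * N + k) ^ 2 + 2 * (s * B) * (k * N)
      ≡⟨ swap-last ((s * B ∸ k * N) ^ 2) _ _ ⟩
    (s * B ∸ k * N) ^ 2 + 2 * (s * B) * (k * N) + B * (s * N + k) ^ 2
      ≡⟨ cong (_+ B * (s * N + k) ^ 2) (monus-square kN≤sB) ⟩
    (s * B) ^ 2 + (k * N) ^ 2 + B * (s * N + k) ^ 2
      ≡⟨ expand s k N B ⟩
    k ^ 2 * (N ^ 2 + B) + B * (s ^ 2 * (N ^ 2 + B)) + 2 * (s * B) * (k * N)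
      ≡⟨ cong (λ x → k ^ 2 * x + B * (s ^ 2 * x) + 2 * (s * B) * (k * N)) N²+B≡q ⟩
    k ^ 2 * q + B * (s ^ 2 * q) + 2 * (s * B) * (k * N) ∎))
  where
  open ≡-Reasoning
  expand : ∀ s k N B → (s * B) ^ 2 + (k * N) ^ 2 + B * (s * N + k) ^ 2
                     ≡ k ^ 2 * (N ^ 2 + B) + B * (s ^ 2 * (N ^ 2 + B)) + 2 * (s * B) * (k * N)
  expand = solve 4 (λ s k N B →
    (s :* B) :^ 2 :+ (k :* N) :^ 2 :+ B :* (s :* N :+ k) :^ 2
      := k :^ 2 :* (N :^ 2 :+ B) :+ B :* (s :^ 2 :* (N :^ 2 :+ B)) :+ con 2 :* (s :* B) :* (k :* N)) refl
... | no kN≰sB = begin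
    s ^ 2 * q                                      ≡⟨ cong (s ^ 2 *_) N²+B≡q ⟨
    s ^ 2 * (N ^ 2 + B)                            ≡⟨ split s N B ⟩
    (s * N) ^ 2 + s * (s * B)                      ≤⟨ +-monoʳ-≤ _ (*-monoʳ-≤ s (<⇒≤ (≰⇒> kN≰sB))) ⟩
    (s * N) ^ 2 + s * (k * N)                      ≤⟨ +-monoʳ-≤ _ (m≤m+n (s * (k * N)) (s * (k * N) + k ^ 2)) ⟩
    (s * N) ^ 2 + (s * (k * N) + (s * (k * N) + k ^ 2)) ≡⟨ expand s N k ⟩
    (s * N + k) ^ 2                                ∎
  where
  open ≤-Reasoning
  split : ∀ s N B → s ^ 2 * (N ^ 2 + B) ≡ (s * N) ^ 2 + s * (s * B)
  split = solve 3 (λ s N B → s :^ 2 :* (N :^ 2 :+ B) := (s :* N) :^ 2 :+ s :* (s :* B)) refl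
  expand : ∀ s N k → (s * N) ^ 2 + (s * (k * N) + (s * (k * N) + k ^ 2)) ≡ (s * N + k) ^ 2
  expand = solve 3 (λ s N k →
    (s :* N) :^ 2 :+ (s :* (k :* N) :+ (s :* (k :* N) :+ k :^ 2)) := (s :* N :+ k) :^ 2) refl

-- Right estimate: if a + c = M² with c > 0 and sc − kM ≤ k√a, then sM − k ≤ s√a.
-- When k ≤ sM and kM ≤ sc this rests on the identity
-- (sc − kM)² + c·s²a = k²a + c(sM − k)².
right-bound : ∀ {a M c s k} → 0 < c → a + c ≡ M ^ 2 →
              (s * c ∸ k * M) ^ 2 ≤ k ^ 2 * a → (s * M ∸ k) ^ 2 ≤ s ^ 2 * a
right-bound {a} {M} {c} {s} {k} c>0 a+c≡M² hyp with k ≤? s * M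
... | no k≰sM = subst (λ w → w ^ 2 ≤ s ^ 2 * a) (sym (m≤n⇒m∸n≡0 (≰⇒≥ k≰sM))) z≤n
... | yes k≤sM with k * M ≤? s * c
...   | yes kM≤sc = weighted-cancel c>0 hyp (+-cancelʳ-≡ (2 * (s * c) * (k * M)) _ _ (begin
    (s * c ∸ k * M) ^ 2 + c * (s ^ 2 * a) + 2 * (s * c) * (k * M)
      ≡⟨ swap-last ((s * c ∸ k * M) ^ 2) _ _ ⟩
    (s * c ∸ k * M) ^ 2 + 2 * (s * c) * (k * M) + c * (s ^ 2 * a)
      ≡⟨ cong (_+ c * (s ^ 2 * a)) (monus-square kM≤sc) ⟩
    (s * c) ^ 2 + (k * M) ^ 2 + c * (s ^ 2 * a)
      ≡⟨ cong (λ x → (s * c) ^ 2 + x + c * (s ^ 2 * a)) (scaled-M² k) ⟩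
    (s * c) ^ 2 + k ^ 2 * (a + c) + c * (s ^ 2 * a)
      ≡⟨ expand s k c a ⟩
    k ^ 2 * a + c * (s ^ 2 * (a + c) + k ^ 2)
      ≡⟨ cong (λ x → k ^ 2 * a + c * (x + k ^ 2)) (scaled-M² s) ⟨
    k ^ 2 * a + c * ((s * M) ^ 2 + k ^ 2)
      ≡⟨ cong (λ x → k ^ 2 * a + c * x) (monus-square k≤sM) ⟨
    k ^ 2 * a + c * ((s * M ∸ k) ^ 2 + 2 * (s * M) * k)
      ≡⟨ regroup k a c (s * M ∸ k) s M ⟩
    k ^ 2 * a + c * (s * M ∸ k) ^ 2 + 2 * (s * c) * (k * M) ∎))
  where
  open ≡-Reasoning
  scaled-M² : ∀ x → (x * M) ^ 2 ≡ x ^ 2 * (a + c)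
  scaled-M² x = trans (product-square x M) (cong (x ^ 2 *_) (sym a+c≡M²))
  expand : ∀ s k c a → (s * c) ^ 2 + k ^ 2 * (a + c) + c * (s ^ 2 * a)
                     ≡ k ^ 2 * a + c * (s ^ 2 * (a + c) + k ^ 2)
  expand = solve 4 (λ s k c a →
    (s :* c) :^ 2 :+ k :^ 2 :* (a :+ c) :+ c :* (s :^ 2 :* a)
      := k :^ 2 :* a :+ c :* (s :^ 2 :* (a :+ c) :+ k :^ 2)) refl
  regroup : ∀ k a c w s M → k ^ 2 * a + c * (w ^ 2 + 2 * (s * M) * k)
                          ≡ k ^ 2 * a + c * w ^ 2 + 2 * (s * c) * (k * M)
  regroup = solve 6 (λ k a c w s M →
    k :^ 2 :* a :+ c :* (w :^ 2 :+ con 2 :* (s :* M) :* k)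
      := k :^ 2 :* a :+ c :* w :^ 2 :+ con 2 :* (s :* c) :* (k :* M)) refl
...   | no kM≰sc = +-cancelʳ-≤ (2 * (s * M) * k) _ _ (begin
    (s * M ∸ k) ^ 2 + 2 * (s * M) * k        ≡⟨ monus-square k≤sM ⟩
    (s * M) ^ 2 + k ^ 2                      ≡⟨ cong (_+ k ^ 2) (product-square s M) ⟩
    s ^ 2 * M ^ 2 + k ^ 2                    ≡⟨ cong (λ x → s ^ 2 * x + k ^ 2) a+c≡M² ⟨
    s ^ 2 * (a + c) + k ^ 2                  ≡⟨ split s a c k ⟩
    s ^ 2 * a + (s * (s * c) + k * k)        ≤⟨ +-monoʳ-≤ (s ^ 2 * a)
                                                 (+-mono-≤ (*-monoʳ-≤ s (<⇒≤ (≰⇒> kM≰sc))) (*-monoʳ-≤ k k≤sM)) ⟩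
    s ^ 2 * a + (s * (k * M) + k * (s * M))  ≡⟨ merge s a k M ⟩
    s ^ 2 * a + 2 * (s * M) * k              ∎)
  where
  open ≤-Reasoning
  split : ∀ s a c k → s ^ 2 * (a + c) + k ^ 2 ≡ s ^ 2 * a + (s * (s * c) + k * k)
  split = solve 4 (λ s a c k →
    s :^ 2 :* (a :+ c) :+ k :^ 2 := s :^ 2 :* a :+ (s :* (s :* c) :+ k :* k)) refl
  merge : ∀ s a k M → s ^ 2 * a + (s * (k * M) + k * (s * M)) ≡ s ^ 2 * a + 2 * (s * M) * k
  merge = solve 4 (λ s a k M →
    s :^ 2 :* a :+ (s :* (k :* M) :+ k :* (s :* M)) := s :^ 2 :* a :+ con 2 :* (s :* M) :* k) refl

module Windows (a : ℕ) where
  open Parameters a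

  sN-below : ∀ s → (s * N) ^ 2 ≤ s ^ 2 * a
  sN-below s = subst (_≤ s ^ 2 * a) (sym (product-square s N)) (*-monoʳ-≤ (s ^ 2) N²≤a)

  sM-above : ∀ s → s ^ 2 * (a + 1) ≤ (s * M) ^ 2
  sM-above s = subst (s ^ 2 * (a + 1) ≤_) (sym (product-square s M))
                     (*-monoʳ-≤ (s ^ 2) (subst (_≤ M ^ 2) (+-comm 1 a) a<M²))

  left-window : ∀ k s → s ≤ˢ kσl k a → Window a s (s * N) k
  left-window k s s≤kσl t =
    InT-between {a} {s} (sN-below s) (left-bound {a + 1} {N} {B} {s} {k} B>0 N²+B≡a+1 s≤kσl)

  right-window : ∀ k s → s ≤ˢ kσr k a → Window a s (s * M ∸ k) k
  right-window k s s≤kσr t t∈T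
    with InT-between {a} {s} (right-bound {a} {M} {c} {s} {k} c>0 a+c≡M² s≤kσr) (sM-above s) t∈T
  ... | L<t , t<sM = L<t , <-≤-trans t<sM (subst (s * M ≤_) (+-comm k (s * M ∸ k)) (m≤n+m∸n (s * M) k))

  window : ∀ k s → s ≤max[ k , a ] → ∃ λ L → Window a s L k
  window k s (inj₁ s≤kσl) = s * N , left-window k s s≤kσl
  window k s (inj₂ s≤kσr) = s * M ∸ k , right-window k s s≤kσr

  τ<k : ∀ k s → 0 < k → s ≤max[ k , a ] → τ s a < k
  τ<k k s k>0 s≤max with window k s s≤max
  ... | L , T⊆window = τ<width {a} {s} {L} {k} k>0 T⊆window

-- A natural number above the surd x = (p + √q)/d (d > 0) is above ⌊x⌋:
-- if (sd − p)² > q then ⌊√q⌋ < sd − p, so p + ⌊√q⌋ < sd.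
floor-below : ∀ {s p q d} → 0 < d → ¬ (s ≤ˢ surd p q d) → ⌊ surd p q d ⌋ˢ < s
floor-below {s} {p} {q} {suc e} _ s≰x = m<n*o⇒m/o<n p+r<sd
  where
  r = isqrt q
  r<sd−p : r < s * suc e ∸ p
  r<sd−p = square-reflects-< (≤-<-trans (proj₁ (isqrt-spec q)) (≰⇒> s≰x))
  p+r<sd : p + r < s * suc e
  p+r<sd with p ≤? s * suc e
  ... | yes p≤sd = subst (p + r <_) (m+[n∸m]≡n p≤sd) (+-monoʳ-< p r<sd−p)
  ... | no p≰sd = contradiction (subst (r <_) (m≤n⇒m∸n≡0 (≰⇒≥ p≰sd)) r<sd−p) λ ()

σ-below : ∀ k a s → ¬ s ≤max[ k , a ] → σ_ k a ≤ s
σ-below k a s s≰max = subst (_≤ s) (+-comm 1 _)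
  (⊔-lub (floor-below (Parameters.B>0 a) (λ s≤kσl → s≰max (inj₁ s≤kσl)))
         (floor-below (Parameters.c>0 a) (λ s≤kσr → s≰max (inj₂ s≤kσr))))

-- No r satisfies r² = (2r + 1)·a with a > 0: for r ≥ 1 the number 2r + 1 would
-- divide 4r² = (2r + 1)(2r − 1) + 1, hence divide 1.
no-square-multiple : ∀ r {a} → 0 < a → r ^ 2 ≢ suc (2 * r) * a
no-square-multiple zero {a} a>0 eq = <⇒≱ a>0 (≤-reflexive (trans (sym (*-identityˡ a)) (sym eq)))
no-square-multiple (suc r) {a} _ eq = contradiction (∣1⇒≡1 (∣m+n∣m⇒∣n d∣d*[2r+1]+1 (m∣m*n (suc (2 * r))))) λ ()
  where
  open ≡-Reasoning
  d = suc (2 * suc r)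
  four-squares : ∀ r → 4 * suc r ^ 2 ≡ suc (2 * suc r) * suc (2 * r) + 1
  four-squares = solve 1 (λ r →
    con 4 :* (con 1 :+ r) :^ 2 := (con 1 :+ con 2 :* (con 1 :+ r)) :* (con 1 :+ con 2 :* r) :+ con 1) refl
  rearrange : ∀ d a → 4 * (d * a) ≡ 4 * a * d
  rearrange = solve 2 (λ d a → con 4 :* (d :* a) := con 4 :* a :* d) refl
  d∣d*[2r+1]+1 : d ∣ d * suc (2 * r) + 1
  d∣d*[2r+1]+1 = divides (4 * a) (begin
    d * suc (2 * r) + 1  ≡⟨ four-squares r ⟨
    4 * suc r ^ 2        ≡⟨ cong (4 *_) eq ⟩
    4 * (d * a)          ≡⟨ rearrange d a ⟩
    4 * a * d            ∎)

-- The candidate ⌊s√a⌋ + 1 for the least element of T_s(a).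
module Candidate (a : ℕ) where
  root : ℕ → ℕ
  root s = isqrt (s ^ 2 * a)

  candidate : ℕ → ℕ
  candidate s = suc (root s)

  candidate-above : ∀ s → s ^ 2 * a < candidate s ^ 2
  candidate-above s = proj₂ (isqrt-spec (s ^ 2 * a))

  candidate-least : ∀ {s t} → InT a s t → candidate s ≤ t
  candidate-least {s} (s²a<t² , _) =
    square-reflects-< (≤-<-trans (proj₁ (isqrt-spec (s ^ 2 * a))) s²a<t²)

  -- Hence T_s(a) ≠ ∅ exactly when the candidate lies in T_s(a), which is decidable.
  nonempty? : ∀ s → Dec (∃ (InT a s))
  nonempty? s = map′ (λ fits → candidate s , candidate-above s , fits)
                     (λ (t , t∈T) → ≤-<-trans (^-monoˡ-≤ 2 (candidate-least {s} {t} t∈T)) (proj₂ t∈T))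
                     (candidate s ^ 2 <? s ^ 2 * (a + 1))

  -- The candidate lies in T_s(a) once 2⌊s√a⌋ + 1 < s², because
  -- (r + 1)² = r² + 2r + 1 ≤ s²a + 2r + 1 < s²a + s² = s²(a + 1).
  candidate-fits : ∀ s → 2 * root s + 1 < s ^ 2 → InT a s (candidate s)
  candidate-fits s 2r+1<s² = candidate-above s , (begin-strict
    suc r ^ 2                ≡⟨ expand r ⟩
    r ^ 2 + (2 * r + 1)      ≤⟨ +-monoˡ-≤ (2 * r + 1) (proj₁ (isqrt-spec (s ^ 2 * a))) ⟩
    s ^ 2 * a + (2 * r + 1)  <⟨ +-monoʳ-< (s ^ 2 * a) 2r+1<s² ⟩
    s ^ 2 * a + s ^ 2        ≡⟨ cong (s ^ 2 * a +_) (*-identityʳ (s ^ 2)) ⟨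
    s ^ 2 * a + s ^ 2 * 1    ≡⟨ *-distribˡ-+ (s ^ 2) a 1 ⟨
    s ^ 2 * (a + 1)          ∎)
    where
    open ≤-Reasoning
    r = root s
    expand : ∀ r → suc r ^ 2 ≡ r ^ 2 + (2 * r + 1)
    expand = solve 1 (λ r → (con 1 :+ r) :^ 2 := r :^ 2 :+ (con 2 :* r :+ con 1)) refl

  -- T_{2M}(a) ≠ ∅ whenever a < M²: then ⌊2M√a⌋ < 2M·M, so 2⌊2M√a⌋ + 1 < 4M².
  nonempty-at-2M : ∀ M → a < M ^ 2 → ∃ (InT a (2 * M))
  nonempty-at-2M zero ()
  nonempty-at-2M M@(suc _) a<M² = candidate (2 * M) , candidate-fits (2 * M) (begin
    suc (2 * r + 1)     ≡⟨ cong suc (+-comm (2 * r) 1) ⟩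
    2 + 2 * r           ≡⟨ *-suc 2 r ⟨
    2 * suc r           ≤⟨ *-monoʳ-≤ 2 r<2M·M ⟩
    2 * (2 * M * M)     ≡⟨ double-square M ⟩
    (2 * M) ^ 2         ∎)
    where
    open ≤-Reasoning
    r = root (2 * M)
    double-square : ∀ M → 2 * (2 * M * M) ≡ (2 * M) ^ 2
    double-square = solve 1 (λ M → con 2 :* (con 2 :* M :* M) := (con 2 :* M) :^ 2) refl
    r<2M·M : r < 2 * M * M
    r<2M·M = square-reflects-< (≤-<-trans (proj₁ (isqrt-spec ((2 * M) ^ 2 * a)))
               (subst ((2 * M) ^ 2 * a <_) (sym (product-square (2 * M) M))
                      (*-monoʳ-< ((2 * M) ^ 2) a<M²)))

  -- T_u(a) ≠ ∅ whenever √(a+1) + √a ≤ u.  With v = u² − 1 the hypothesis gives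
  -- 2⌊u√a⌋ ≤ v, and equality would force ⌊u√a⌋² = (2⌊u√a⌋ + 1)·a.
  nonempty-below-sqrt-sum : 0 < a → ∀ u → SqrtSum≤ a u → ∃ (InT a u)
  nonempty-below-sqrt-sum a>0 u (a≤u² , _ , sqrt-sum-bound) =
    candidate u , candidate-fits u 2r+1<u²
    where
    r = root u
    v = u ^ 2 ∸ 1
    1+v≡u² : 1 + v ≡ u ^ 2
    1+v≡u² = m+[n∸m]≡n (≤-trans a>0 a≤u²)
    r²≤u²a : r ^ 2 ≤ u ^ 2 * a
    r²≤u²a = proj₁ (isqrt-spec (u ^ 2 * a))
    4u²a≤v² : 4 * (u ^ 2 * a) ≤ v ^ 2
    4u²a≤v² = subst₂ _≤_ (*-assoc 4 (u ^ 2) a)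
      (cong (_^ 2) (trans (sym (∸-+-assoc (u ^ 2 + a) a 1)) (cong (_∸ 1) (m+n∸n≡m (u ^ 2) a))))
      sqrt-sum-bound
    2r≤v : 2 * r ≤ v
    2r≤v = square-reflects-≤
      (subst (_≤ v ^ 2) (sym (product-square 2 r)) (≤-trans (*-monoʳ-≤ 4 r²≤u²a) 4u²a≤v²))
    2r≢v : 2 * r ≢ v
    2r≢v 2r≡v = no-square-multiple r a>0 (trans r²≡u²a (cong (_* a) u²≡1+2r))
      where
      u²≡1+2r : u ^ 2 ≡ suc (2 * r)
      u²≡1+2r = trans (sym 1+v≡u²) (cong suc (sym 2r≡v))
      4u²a≤4r² : 4 * (u ^ 2 * a) ≤ 4 * r ^ 2
      4u²a≤4r² = subst (4 * (u ^ 2 * a) ≤_) (product-square 2 r)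
                   (subst (λ x → 4 * (u ^ 2 * a) ≤ x ^ 2) (sym 2r≡v) 4u²a≤v²)
      r²≡u²a : r ^ 2 ≡ u ^ 2 * a
      r²≡u²a = ≤-antisym r²≤u²a (*-cancelˡ-≤ 4 4u²a≤4r²)
    2r+1<u² : 2 * r + 1 < u ^ 2
    2r+1<u² = subst (suc (2 * r + 1) ≤_) 1+v≡u²
                (s≤s (subst (_≤ v) (+-comm 1 (2 * r)) (≤∧≢⇒< 2r≤v 2r≢v)))

module LeastNumber {P : ℕ → Set} (P? : Decidable P) where
  Least : ℕ → Set
  Least s = P s × (∀ m → m < s → ¬ P m)

  search : ∀ n → (∀ m → m < n → ¬ P m) ⊎ ∃ Least
  search zero = inj₁ (λ _ ())
  search (suc n) with search n
  ... | inj₂ least = inj₂ least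
  ... | inj₁ none-below with P? n
  ...   | yes Pn = inj₂ (n , Pn , none-below)
  ...   | no ¬Pn = inj₁ none-below-suc
    where
    none-below-suc : ∀ m → m < suc n → ¬ P m
    none-below-suc m m<1+n with m<1+n⇒m<n∨m≡n m<1+n
    ... | inj₁ m<n  = none-below m m<n
    ... | inj₂ refl = ¬Pn

  least : ∀ {u} → P u → ∃ Least
  least {u} Pu with search (suc u)
  ... | inj₁ none-below = contradiction Pu (none-below u (n<1+n u))
  ... | inj₂ least-witness = least-witness

module Sigma (a : ℕ) (a>0 : 0 < a) where
  open Candidate a

  -- s is a positive denominator of a rational in (√a, √(a+1)).
  Admissible : ℕ → Set
  Admissible s = 0 < s × ∃ (InT a s)

  open LeastNumber {Admissible} (λ s → (0 <? s) ×-dec nonempty? s)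

  -- T_s(a) ≠ ∅ fits in no window of width 1, so s exceeds σ_1(a).
  σ₁≤ : ∀ {s t} → InT a s t → σ_ 1 a ≤ s
  σ₁≤ {s} {t} t∈T = σ-below 1 a s (λ s≤max → width-one-empty {a} {s} t (proj₂ (Windows.window a 1 s s≤max)) t∈T)

  admissible-sqrt-sum : ∀ u → SqrtSum≤ a u → Admissible u
  admissible-sqrt-sum zero (a≤0 , _) = contradiction a≤0 (<⇒≱ a>0)
  admissible-sqrt-sum u@(suc _) sqrt-sum≤u = s≤s z≤n , nonempty-below-sqrt-sum a>0 u sqrt-sum≤u

  admissible-2M : Admissible (2 * mA a)
  admissible-2M = ≤-trans (m≤n+m 1 (nA a)) (m≤m+n (mA a) (1 * mA a))
                , nonempty-at-2M (mA a) (Parameters.a<M² a)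

  σ-exists : ∃ λ σa → IsSigma a σa × σ_ 1 a ≤ σa × (∀ u → IsCeilSqrtSum a u → σa ≤ u)
  σ-exists with least admissible-2M
  ... | σa , (σa>0 , t , t∈T) , below =
    σa , (σa>0 , (t , t∈T) , λ s s>0 s<σa t′ t′∈T → below s s<σa (s>0 , t′ , t′∈T))
       , σ₁≤ {σa} {t} t∈T
       , λ u (sqrt-sum≤u , _) → ≮⇒≥ (λ u<σa → below u u<σa (admissible-sqrt-sum u sqrt-sum≤u))

theorem2 : (a : ℕ) → 1 ≤ a →
    ((k s : ℕ) → 1 ≤ k → 1 ≤ s → s ≤max[ k , a ] → τ s a < k)
    × ((k s : ℕ) → 1 ≤ k → 1 ≤ s → τ s a ≥ k → s ≥ σ_ k a)
    × (∃ λ σa → IsSigma a σa × σ_ 1 a ≤ σa × (∀ u → IsCeilSqrtSum a u → σa ≤ u))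
theorem2 a a>0 =
    (λ k s k>0 _ s≤max → Windows.τ<k a k s k>0 s≤max)
  , (λ k s k>0 _ τ≥k → σ-below k a s (λ s≤max → <⇒≱ (Windows.τ<k a k s k>0 s≤max) τ≥k))
  , Sigma.σ-exists a a>0
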